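{- For any instance $(P,D)$ of \textsc{MinGMConn} such that the demand graph $(P,D)$ is connected, $\mathrm{opt}(P,D)\ge|P|-1$.
   Context: For a finite $X\subseteq\mathbb{R}^2$, $p,q\in X$ are M-connected in $X$ if there is a sequence $p=x_0,\dots,x_k=q$ in $X$ with consecutive points horizontally or vertically aligned and $\sum_i\|x_i-x_{i+1}\|_1=\|p-q\|_1$. An instance: finite $P\subseteq\mathbb{R}^2$ with no two points in the same row or column, and demands $D\subseteq P\times P$; a feasible solution is $Q\subseteq\mathbb{R}^2$ such that every $(p,q)\in D$ is M-connected in $P\cup Q$; $\mathrm{opt}(P,D)$ is the minimum size of a feasible solution. The demand graph is the graph on vertex set $P$ with edge set $D$. -}

module Defs where

open import Level using (0ℓ)
open import Data.Nat using (ℕ)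
open import Data.Fin using (Fin)
open import Data.Product using (Σ; ∃; _×_; _,_; proj₁; proj₂)
open import Data.Sum using (_⊎_)
open import Data.List using (List)
open import Data.List.Membership.Propositional using (_∈_)
open import Relation.Nullary using (¬_)
open import Relation.Binary.Core using (Rel)
open import Relation.Binary.Structures using (IsTotalOrder)
open import Relation.Binary.PropositionalEquality using (_≡_)
open import Algebra.Structures using (IsCommutativeRing)

-- The real numbers are
-- such a structure; the statement is made for every ordered field, which
-- in particular covers ℝ (the library has no reals).
record OrderedField : Set₁ where
  infixl 6 _+_
  infixl 7 _*_
  infix  8 -_
  infix  4 _≤_
  field
    Carrier : Set
    _+_ _*_ : Carrier → Carrier → Carrier
    -_      : Carrier → Carrier
    0# 1#   : Carrier
    isCommutativeRing : IsCommutativeRing _≡_ _+_ _*_ -_ 0# 1#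
    0≢1     : ¬ (0# ≡ 1#)
    inverse : ∀ x → ¬ (x ≡ 0#) → Σ Carrier (λ y → x * y ≡ 1#)
    _≤_     : Rel Carrier 0ℓ
    isTotalOrder : IsTotalOrder _≡_ _≤_
    +-monoˡ-≤ : ∀ {x y} z → x ≤ y → x + z ≤ y + z
    *-nonneg  : ∀ {x y} → 0# ≤ x → 0# ≤ y → 0# ≤ x * y
    abs : Carrier → Carrier
    abs-nonneg : ∀ {x} → 0# ≤ x → abs x ≡ x
    abs-nonpos : ∀ {x} → x ≤ 0# → abs x ≡ - x

module Geometry (F : OrderedField) where
  open OrderedField F

  _-_ : Carrier → Carrier → Carrier
  a - b = a + (- b)

  Point : Set
  Point = Carrier × Carrier

  xc yc : Point → Carrier
  xc = proj₁
  yc = proj₂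

  dist₁ : Point → Point → Carrier
  dist₁ p q = abs (xc p - xc q) + abs (yc p - yc q)

  Aligned : Point → Point → Set
  Aligned p q = (xc p ≡ xc q) ⊎ (yc p ≡ yc q)

  data Walk (X : Point → Set) : Point → Point → Set where
    done : ∀ {p} → Walk X p p
    step : ∀ {p r q} → Aligned p r → X r → Walk X r q → Walk X p q

  length₁ : ∀ {X p q} → Walk X p q → Carrier
  length₁ done = 0#
  length₁ (step {p} {r} _ _ w) = dist₁ p r + length₁ w

  MConnected : (X : Point → Set) → Point → Point → Set
  MConnected X p q =
    X p × X q × Σ (Walk X p q) (λ w → length₁ w ≡ dist₁ p q)

  InUnion : ∀ {n} → (Fin n → Point) → List Point → Point → Set
  InUnion P Q r = (∃ λ i → P i ≡ r) ⊎ (r ∈ Q)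

  GeneralPosition : ∀ {n} → (Fin n → Point) → Set
  GeneralPosition {n} P =
    ∀ (i j : Fin n) → ¬ (i ≡ j) → ¬ (xc (P i) ≡ xc (P j)) × ¬ (yc (P i) ≡ yc (P j))

  Feasible : ∀ {n} → (Fin n → Point) → List (Fin n × Fin n) → List Point → Set
  Feasible P D Q = ∀ {i j} → (i , j) ∈ D → MConnected (InUnion P Q) (P i) (P j)

data Reach {n : ℕ} (D : List (Fin n × Fin n)) : Fin n → Fin n → Set where
  here : ∀ {i} → Reach D i i
  fwd  : ∀ {i j k} → (i , j) ∈ D → Reach D j k → Reach D i k
  bwd  : ∀ {i j k} → (j , i) ∈ D → Reach D j k → Reach D i k

ConnectedGraph : (n : ℕ) → List (Fin n × Fin n) → Set
ConnectedGraph n D = ∀ (i j : Fin n) → Reach D i j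

-- Make every point of P ∪ Q an edge joining its column to its row in a bipartite
-- graph on the columns and rows of the plane.  A monotone path only moves along
-- a column or a row, so each demand makes the columns of its two terminals
-- connected in this graph, and since the demand graph is connected, the 2|P|
-- columns and rows of P (pairwise distinct by general position) all lie in one
-- component.  A connected set of v vertices needs at least v − 1 edges, whence
-- 2|P| − 1 ≤ |P| + |Q|.  Equality of coordinates in an ordered field need not be
-- decidable, but only finitely many coordinates are compared and the goal is a
-- decidable inequality on ℕ, so decidability may be assumed under ¬ ¬.

module Submission where

open import Defs
open import Level using (0ℓ)
open import Function using (_∘_)
open import Data.Empty using (⊥-elim)
open import Data.Nat using (ℕ; zero; suc; _+_; _∸_; _≤_; _≤?_; z≤n; s≤s)
open import Data.Nat.Properties using (≤-refl; ≤-trans; suc-injective; +-suc; +-cancelˡ-≤; ∸-monoˡ-≤)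
open import Data.Fin using (Fin; zero; suc; splitAt; _↑ˡ_; _↑ʳ_)
open import Data.Fin.Properties using (splitAt-↑ˡ; splitAt-↑ʳ; sequence)
import Data.Fin.Properties as Fin
open import Data.Maybe using (Maybe; just; nothing)
import Data.Maybe as Maybe
import Data.Maybe.Properties as Maybe
open import Data.Product using (∃; _×_; _,_; proj₁; proj₂)
import Data.Product as Product
open import Data.Sum using (_⊎_; inj₁; inj₂; [_,_]′)
import Data.Sum.Properties as Sum
open import Data.List using (List; []; _∷_; length; map; filter; lookup; tabulate; _++_)
open import Data.List.Properties using (filter-all; length-map; length-tabulate; length-++)
import Data.List.Relation.Unary.All as All
open import Data.List.Relation.Unary.All using (_∷_)
open import Data.List.Relation.Unary.AllPairs using (_∷_)
open import Data.List.Relation.Unary.Any using (here; there; index)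
open import Data.List.Relation.Unary.Any.Properties using (lookup-index)
open import Data.List.Membership.Propositional using (_∈_)
open import Data.List.Membership.Propositional.Properties
  using (∈-filter⁻; ∈-map⁺; ∈-tabulate⁺; ∈-tabulate⁻; ∈-++⁻)
open import Data.List.Relation.Unary.Unique.Propositional using (Unique)
open import Data.List.Relation.Unary.Unique.Propositional.Properties using (filter⁺; ++⁺; tabulate⁺)
open import Relation.Nullary using (¬_; Dec; yes; no; ¬?)
open import Relation.Nullary.Decidable using (decidable-stable; ¬¬-excluded-middle)
open import Relation.Nullary.Negation using (¬¬-Monad)
open import Relation.Unary using (Pred; Decidable)
open import Relation.Binary.Core using (Rel; _⇒_; _=[_]⇒_)
open import Relation.Binary.Definitions using (DecidableEquality)
open import Relation.Binary.PropositionalEquality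
  using (_≡_; _≢_; refl; sym; trans; cong; cong₂; subst; subst₂; isEquivalence)
open import Relation.Binary.Construct.Closure.Equivalence using (EqClosure; transitive; symmetric; gfold; fold; return)
import Relation.Binary.Construct.Closure.Equivalence as EquivalenceClosure
open import Relation.Binary.Construct.Closure.ReflexiveTransitive using (ε)
open import Effect.Monad using (RawMonad)

module Graph {A : Set} (_≟_ : DecidableEquality A) where

  Edge : List (A × A) → Rel A 0ℓ
  Edge E u v = (u , v) ∈ E

  Connected : List (A × A) → Rel A 0ℓ
  Connected E = EqClosure (Edge E)

  AllConnected : List (A × A) → List A → Set
  AllConnected E S = ∀ {x y} → x ∈ S → y ∈ S → Connected E x y

  connected-[] : Connected [] ⇒ _≡_
  connected-[] = fold isEquivalence λ ()

  module Contraction (a b : A) where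

    merge : A → A
    merge x with x ≟ b
    ... | yes _ = a
    ... | no _  = x

    merge-a : merge a ≡ a
    merge-a with a ≟ b
    ... | yes _ = refl
    ... | no _  = refl

    merge-b : merge b ≡ a
    merge-b with b ≟ b
    ... | yes _  = refl
    ... | no b≢b = ⊥-elim (b≢b refl)

    merge-≢ : ∀ {x} → x ≢ b → merge x ≡ x
    merge-≢ {x} x≢b with x ≟ b
    ... | yes x≡b = ⊥-elim (x≢b x≡b)
    ... | no _    = refl

    contract : List (A × A) → List (A × A)
    contract = map (Product.map merge merge)

    connected-contract : ∀ {E} → Connected ((a , b) ∷ E) =[ merge ]⇒ Connected (contract E)
    connected-contract {E} = gfold (EquivalenceClosure.isEquivalence _) merge merge-edge
      where
      merge-edge : Edge ((a , b) ∷ E) =[ merge ]⇒ Connected (contract E)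
      merge-edge (here refl) = subst (Connected (contract E) (merge a)) (trans merge-a (sym merge-b)) ε
      merge-edge (there e)   = return (∈-map⁺ (Product.map merge merge) e)

    ≢b? : Decidable (_≢ b)
    ≢b? x = ¬? (x ≟ b)

    delete : List A → List A
    delete = filter ≢b?

    length-delete : ∀ S → Unique S → length S ≤ suc (length (delete S))
    length-delete []      _            = z≤n
    length-delete (x ∷ S) (x∉S ∷ uniq) with x ≟ b
    ... | yes refl = s≤s (subst (λ L → length S ≤ length L) (sym (filter-all _ b∉S)) ≤-refl)
      where b∉S = All.map (λ b≢y y≡b → b≢y (sym y≡b)) x∉S
    ... | no _     = s≤s (length-delete S uniq)

    allConnected-delete : ∀ {E S} → AllConnected ((a , b) ∷ E) S → AllConnected (contract E) (delete S)
    allConnected-delete {E} {S} conn x∈ y∈ with ∈-filter⁻ ≢b? {xs = S} x∈ | ∈-filter⁻ ≢b? {xs = S} y∈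
    ... | x∈S , x≢b | y∈S , y≢b = subst₂ (Connected (contract E)) (merge-≢ x≢b) (merge-≢ y≢b) (connected-contract (conn x∈S y∈S))

  -- Contracting the edge (a , b) merges b into a: one edge and at most one
  -- vertex of S disappear.
  length≤suc-edges′ : ∀ k E S → length E ≡ k → Unique S → AllConnected E S → length S ≤ suc k
  length≤suc-edges′ _ []      []          refl _                  _    = z≤n
  length≤suc-edges′ _ []      (_ ∷ [])    refl _                  _    = s≤s z≤n
  length≤suc-edges′ _ []      (_ ∷ _ ∷ _) refl ((x≢y ∷ _) ∷ _)    conn = ⊥-elim (x≢y (connected-[] (conn (here refl) (there (here refl)))))
  length≤suc-edges′ (suc k) ((a , b) ∷ E) S |E|+1≡k+1 uniq conn =
    ≤-trans (length-delete S uniq)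
            (s≤s (length≤suc-edges′ k (contract E) (delete S) (trans (length-map _ E) (suc-injective |E|+1≡k+1))
                                    (filter⁺ ≢b? uniq) (allConnected-delete conn)))
    where open Contraction a b

  length≤suc-edges : ∀ E S → Unique S → AllConnected E S → length S ≤ suc (length E)
  length≤suc-edges E S = length≤suc-edges′ (length E) E S refl

first : ∀ {K} {p : Pred (Fin K) 0ℓ} → Decidable p → Maybe (Fin K)
first {zero}  p? = nothing
first {suc K} p? with p? zero
... | yes _ = just zero
... | no _  = Maybe.map suc (first (p? ∘ suc))

first-cong : ∀ {K} {p q : Pred (Fin K) 0ℓ} (p? : Decidable p) (q? : Decidable q) →
             (∀ i → p i → q i) → (∀ i → q i → p i) → first p? ≡ first q?
first-cong {zero}  p? q? p⇒q q⇒p = refl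
first-cong {suc K} p? q? p⇒q q⇒p with p? zero | q? zero
... | yes _  | yes _  = refl
... | yes p0 | no ¬q0 = ⊥-elim (¬q0 (p⇒q zero p0))
... | no ¬p0 | yes q0 = ⊥-elim (¬p0 (q⇒p zero q0))
... | no _   | no _   = cong (Maybe.map suc) (first-cong (p? ∘ suc) (q? ∘ suc) (p⇒q ∘ suc) (q⇒p ∘ suc))

first-just : ∀ {K} {p : Pred (Fin K) 0ℓ} (p? : Decidable p) k → p k → ∃ λ j → first p? ≡ just j × p j
first-just {suc K} p? k pk with p? zero
... | yes p0 = zero , refl , p0
first-just {suc K} p? zero    pk | no ¬p0 = ⊥-elim (¬p0 pk)
first-just {suc K} p? (suc k) pk | no _ with first-just (p? ∘ suc) k pk
... | j , first≡j , pj = suc j , cong (Maybe.map suc) first≡j , pj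

module Labelling {K} {B : Set} (g : Fin K → B) (_≟ᵍ_ : ∀ k l → Dec (g k ≡ g l)) where

  label : Fin K → Maybe (Fin K)
  label k = first (λ l → l ≟ᵍ k)

  ≡⇒label≡ : ∀ {k l} → g k ≡ g l → label k ≡ label l
  ≡⇒label≡ gk≡gl = first-cong _ _ (λ _ e → trans e gk≡gl) (λ _ e → trans e (sym gk≡gl))

  label≡⇒≡ : ∀ {k l} → label k ≡ label l → g k ≡ g l
  label≡⇒≡ {k} {l} label≡ with first-just (λ i → i ≟ᵍ k) k refl | first-just (λ i → i ≟ᵍ l) l refl
  ... | j , first≡j , gj≡gk | j′ , first≡j′ , gj′≡gl with trans (sym first≡j) (trans label≡ first≡j′)
  ... | refl = trans (sym gj≡gk) gj′≡gl

¬¬-decidable₂ : ∀ {K} (R : Fin K → Fin K → Set) → ¬ ¬ (∀ k l → Dec (R k l))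
¬¬-decidable₂ R = ¬¬-sequence (λ k → ¬¬-sequence (λ l → ¬¬-excluded-middle))
  where ¬¬-sequence = sequence (RawMonad.rawApplicative ¬¬-Monad)

module Grid (F : OrderedField) {n} (P : Fin n → Geometry.Point F) (Q : List (Geometry.Point F)) where
  open Geometry F

  N : ℕ
  N = n + length Q

  pt : Fin N → Point
  pt k = [ P , lookup Q ]′ (splitAt n k)

  pt-P : ∀ i → pt (i ↑ˡ length Q) ≡ P i
  pt-P i rewrite splitAt-↑ˡ n i (length Q) = refl

  pt-Q : ∀ t → pt (n ↑ʳ t) ≡ lookup Q t
  pt-Q t rewrite splitAt-↑ʳ n (length Q) t = refl

  pt-surjective : ∀ {r} → InUnion P Q r → ∃ λ t → pt t ≡ r
  pt-surjective (inj₁ (i , Pi≡r)) = i ↑ˡ length Q , trans (pt-P i) Pi≡r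
  pt-surjective (inj₂ r∈Q)        = n ↑ʳ index r∈Q , trans (pt-Q (index r∈Q)) (sym (lookup-index r∈Q))

  module _ (_≟ˣ_ : ∀ k l → Dec (xc (pt k) ≡ xc (pt l))) (_≟ʸ_ : ∀ k l → Dec (yc (pt k) ≡ yc (pt l))) where
    private
      module Col = Labelling (xc ∘ pt) _≟ˣ_
      module Row = Labelling (yc ∘ pt) _≟ʸ_

    -- A line is a column (inj₁) or a row (inj₂), named by the first point of
    -- P ∪ Q on it; the label nothing never occurs.
    Line : Set
    Line = Maybe (Fin N) ⊎ Maybe (Fin N)

    col row : Fin N → Line
    col k = inj₁ (Col.label k)
    row k = inj₂ (Row.label k)

    _≟_ : DecidableEquality Line
    _≟_ = Sum.≡-dec (Maybe.≡-dec Fin._≟_) (Maybe.≡-dec Fin._≟_)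

    open Graph _≟_ public

    grid : List (Line × Line)
    grid = tabulate (λ k → col k , row k)

    col-row : ∀ k → Connected grid (col k) (row k)
    col-row k = return (∈-tabulate⁺ k)

    ≡⇒connected : ∀ {u v} → u ≡ v → Connected grid u v
    ≡⇒connected refl = ε

    aligned⇒connected : ∀ {k l} → Aligned (pt k) (pt l) → Connected grid (col k) (col l)
    aligned⇒connected (inj₁ x≡) = ≡⇒connected (cong inj₁ (Col.≡⇒label≡ x≡))
    aligned⇒connected {k} {l} (inj₂ y≡) =
      transitive _ (col-row k) (transitive _ (≡⇒connected (cong inj₂ (Row.≡⇒label≡ y≡))) (symmetric _ (col-row l)))

    walk⇒connected : ∀ {p q} → Walk (InUnion P Q) p q → ∀ k l → pt k ≡ p → pt l ≡ q → Connected grid (col k) (col l)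
    walk⇒connected done           k l refl pl≡ = ≡⇒connected (cong inj₁ (Col.≡⇒label≡ (cong xc (sym pl≡))))
    walk⇒connected (step al r∈ w) k l refl pl≡ with pt-surjective r∈
    ... | t , refl = transitive _ (aligned⇒connected al) (walk⇒connected w t l refl pl≡)

    module _ (gp : GeneralPosition P) (D : List (Fin n × Fin n)) (feasible : Feasible P D Q) where
      colP rowP : Fin n → Line
      colP i = col (i ↑ˡ length Q)
      rowP i = row (i ↑ˡ length Q)

      demand⇒connected : ∀ {i j} → (i , j) ∈ D → Connected grid (colP i) (colP j)
      demand⇒connected {i} {j} ij∈D with feasible ij∈D
      ... | _ , _ , w , _ = walk⇒connected w _ _ (pt-P i) (pt-P j)

      reach⇒connected : ∀ {i j} → Reach D i j → Connected grid (colP i) (colP j)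
      reach⇒connected here      = ε
      reach⇒connected (fwd e r) = transitive _ (demand⇒connected e) (reach⇒connected r)
      reach⇒connected (bwd e r) = transitive _ (symmetric _ (demand⇒connected e)) (reach⇒connected r)

      colP-injective : ∀ {i j} → colP i ≡ colP j → i ≡ j
      colP-injective {i} {j} eq with i Fin.≟ j
      ... | yes i≡j = i≡j
      ... | no i≢j  = ⊥-elim (proj₁ (gp i j i≢j) (subst₂ (λ p q → xc p ≡ xc q) (pt-P i) (pt-P j)
                                                     (Col.label≡⇒≡ (Sum.inj₁-injective eq))))

      rowP-injective : ∀ {i j} → rowP i ≡ rowP j → i ≡ j
      rowP-injective {i} {j} eq with i Fin.≟ j
      ... | yes i≡j = i≡j
      ... | no i≢j  = ⊥-elim (proj₂ (gp i j i≢j) (subst₂ (λ p q → yc p ≡ yc q) (pt-P i) (pt-P j)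
                                                     (Row.label≡⇒≡ (Sum.inj₂-injective eq))))

      linesP : List Line
      linesP = tabulate colP ++ tabulate rowP

      linesP-unique : Unique linesP
      linesP-unique = ++⁺ (tabulate⁺ colP-injective) (tabulate⁺ rowP-injective) col≢row
        where
        col≢row : ∀ {v} → ¬ (v ∈ tabulate colP × v ∈ tabulate rowP)
        col≢row (v∈cols , v∈rows) with ∈-tabulate⁻ v∈cols | ∈-tabulate⁻ v∈rows
        ... | _ , refl | _ , ()

      linesP⇝colP : ∀ {x} → x ∈ linesP → ∃ λ i → Connected grid x (colP i)
      linesP⇝colP x∈ with ∈-++⁻ (tabulate colP) x∈
      ... | inj₁ x∈cols with ∈-tabulate⁻ x∈cols
      ...   | i , refl = i , ε
      linesP⇝colP x∈ | inj₂ x∈rows with ∈-tabulate⁻ x∈rows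
      ...   | i , refl = i , symmetric _ (col-row (i ↑ˡ length Q))

      linesP-allConnected : ConnectedGraph n D → AllConnected grid linesP
      linesP-allConnected connected x∈ y∈ with linesP⇝colP x∈ | linesP⇝colP y∈
      ... | i , x~i | j , y~j = transitive _ x~i (transitive _ (reach⇒connected (connected i j)) (symmetric _ y~j))

      double≤suc-points : ConnectedGraph n D → n + n ≤ suc N
      double≤suc-points connected =
        subst₂ (λ v e → v ≤ suc e)
               (trans (length-++ (tabulate colP)) (cong₂ _+_ (length-tabulate colP) (length-tabulate rowP)))
               (length-tabulate _)
               (length≤suc-edges grid linesP linesP-unique (linesP-allConnected connected))

n+n≤1+n+m⇒n∸1≤m : ∀ n m → n + n ≤ suc (n + m) → n ∸ 1 ≤ m
n+n≤1+n+m⇒n∸1≤m n m le = ∸-monoˡ-≤ 1 (+-cancelˡ-≤ n n (suc m) (subst (n + n ≤_) (sym (+-suc n m)) le))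

lemma27 : (F : OrderedField) → (n : ℕ) → (P : Fin n → Geometry.Point F) → Geometry.GeneralPosition F P → (D : List (Fin n × Fin n)) → ConnectedGraph n D → (Q : List (Geometry.Point F)) → Geometry.Feasible F P D Q → n ∸ 1 ≤ length Q
lemma27 F n P gp D connected Q feasible =
  decidable-stable (n ∸ 1 ≤? length Q) λ ¬bound →
    ¬¬-decidable₂ (λ k l → xc (pt k) ≡ xc (pt l)) λ _≟ˣ_ →
    ¬¬-decidable₂ (λ k l → yc (pt k) ≡ yc (pt l)) λ _≟ʸ_ →
    ¬bound (n+n≤1+n+m⇒n∸1≤m n (length Q) (double≤suc-points _≟ˣ_ _≟ʸ_ gp D feasible connected))
  where
  open Geometry F
  open Grid F P Q
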